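{- Let $H$ be a $3$-uniform hypergraph with a single-vertex transversal $\{v\}$ (i.e. every edge of $H$ contains $v$), and let $G$ be the trace of $H$ at $v$. Then $r_k(H)\le r_k(G)+1$.
   Context: The trace of a $3$-uniform hypergraph $H$ at a vertex $v$ is the graph with vertex set $V(H)\setminus\{v\}$ and edge set $\{e\setminus\{v\}: e\in E(H),\ v\in e\}$. For a $3$-uniform hypergraph $H$, $r_k(H)$ is the minimum $n$ such that every $k$-coloring of the triples of an $n$-set contains a monochromatic copy of $H$; for a graph $G$, $r_k(G)$ is the minimum $n$ such that every $k$-coloring of the edges of $K_n$ contains a monochromatic copy of $G$. -}

module Defs where

open import Data.Nat using (ℕ; suc; _≤_)
open import Data.Fin using (Fin; punchIn)
open import Data.Fin.Properties using (punchIn-injective)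
open import Data.Product using (Σ; ∃; _,_; _×_)
open import Data.Sum using (_⊎_)
open import Data.Empty using (⊥)
open import Function.Definitions using (Injective)
open import Relation.Binary.PropositionalEquality using (_≡_; _≢_; subst)
open import Relation.Nullary using (¬_)

record Graph (n : ℕ) : Set₁ where
  field
    Adj   : Fin n → Fin n → Set
    sym   : ∀ {x y} → Adj x y → Adj y x
    irrefl : ∀ {x} → ¬ Adj x x
open Graph public

-- 3-uniform hypergraphs on vertex set Fin n: the edge {x,y,z} is
-- recorded by Edge x y z (in every order), and only distinct triples are edges.
record Hypergraph3 (n : ℕ) : Set₁ where
  field
    Edge   : Fin n → Fin n → Fin n → Set
    swap₁₂ : ∀ {x y z} → Edge x y z → Edge y x z
    swap₂₃ : ∀ {x y z} → Edge x y z → Edge x z y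
    distinct : ∀ {x y z} → Edge x y z → x ≢ y × y ≢ z × x ≢ z
open Hypergraph3 public

-- k-colourings of the edges of K_N (symmetric functions; diagonal unused).
record EdgeColouring (k N : ℕ) : Set where
  field
    col  : Fin N → Fin N → Fin k
    csym : ∀ x y → col x y ≡ col y x
open EdgeColouring public

-- k-colourings of the triples of an N-set (symmetric functions; values on
-- non-distinct triples are unused).
record TripleColouring (k N : ℕ) : Set where
  field
    col3   : Fin N → Fin N → Fin N → Fin k
    c3-12  : ∀ x y z → col3 x y z ≡ col3 y x z
    c3-23  : ∀ x y z → col3 x y z ≡ col3 x z y
open TripleColouring public

MonoCopy : ∀ {k m N} → Graph m → EdgeColouring k N → Set
MonoCopy {k} {m} {N} G c =
  Σ (Fin m → Fin N) λ f → Injective _≡_ _≡_ f ×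
    Σ (Fin k) λ i → ∀ x y → Adj G x y → col c (f x) (f y) ≡ i

MonoCopy3 : ∀ {k m N} → Hypergraph3 m → TripleColouring k N → Set
MonoCopy3 {k} {m} {N} H c =
  Σ (Fin m → Fin N) λ f → Injective _≡_ _≡_ f ×
    Σ (Fin k) λ i → ∀ x y z → Edge H x y z → col3 c (f x) (f y) (f z) ≡ i

Arrows : ∀ {m} → ℕ → Graph m → ℕ → Set
Arrows k G N = (c : EdgeColouring k N) → MonoCopy G c

Arrows3 : ∀ {m} → ℕ → Hypergraph3 m → ℕ → Set
Arrows3 k H N = (c : TripleColouring k N) → MonoCopy3 H c

IsRamseyNumber : ∀ {m} → ℕ → Graph m → ℕ → Set
IsRamseyNumber k G r = Arrows k G r × (∀ N → Arrows k G N → r ≤ N)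

IsRamseyNumber3 : ∀ {m} → ℕ → Hypergraph3 m → ℕ → Set
IsRamseyNumber3 k H r = Arrows3 k H r × (∀ N → Arrows3 k H N → r ≤ N)

IsTransversalVertex : ∀ {n} → Hypergraph3 n → Fin n → Set
IsTransversalVertex H v = ∀ x y z → Edge H x y z → x ≡ v ⊎ y ≡ v ⊎ z ≡ v

-- trace of H at v; vertex set V(H) \ {v} ≅ Fin m via punchIn v
trace : ∀ {m} → Hypergraph3 (suc m) → Fin (suc m) → Graph m
trace H v = record
  { Adj = λ x y → Edge H v (punchIn v x) (punchIn v y)
  ; sym = λ e → swap₂₃ H e
  ; irrefl = λ e → let (_ , p , _) = distinct H e in p Relation.Binary.PropositionalEquality.refl
  }

module Submission where

-- Let N be any number with N → (G)_k, where G is the trace of H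
-- at the transversal vertex v.  Given a k-colouring c of the triples of an
-- (N+1)-set, distinguish the point 0 and colour each pair {a,b} of the
-- remaining N points by c{0,a,b}: this is the link colouring of c at 0.  It
-- contains a monochromatic copy f of G, and sending v to 0 and every other
-- vertex w of H (which is punchIn v x for a unique x) to f x gives an
-- embedding of H.  Every edge of H contains v, so it is {v, w, w'} with
-- {w, w'} the image of an edge of G, and its colour c{0, f x, f x'} is the
-- colour of the copy of G.  Hence N + 1 → (H)_k, and minimality of r_k(H)
-- applied to N = r_k(G) gives r_k(H) ≤ r_k(G) + 1.

open import Defs hiding (sym)
open import Data.Nat using (ℕ; suc; _≤_; _+_)
open import Data.Fin using (Fin; zero; suc; punchIn; punchOut; _≟_)
open import Data.Fin.Properties
  using (punchIn-punchOut; punchOut-punchIn; punchOut-cong; punchInᵢ≢i; suc-injective)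
open import Data.Nat.Properties using (+-comm)
open import Data.Product using (_,_; proj₁; proj₂)
open import Data.Sum using (inj₁; inj₂)
open import Data.Empty using (⊥-elim)
open import Function using (_∘′_)
open import Function.Definitions using (Injective)
open import Relation.Nullary using (yes; no)
open import Relation.Binary.PropositionalEquality

data PunchView {n : ℕ} (v : Fin (suc n)) : Fin (suc n) → Set where
  at-v  : PunchView v v
  off-v : (x : Fin n) → PunchView v (punchIn v x)

punchView : ∀ {n} (v w : Fin (suc n)) → PunchView v w
punchView v w with v ≟ w
... | yes refl = at-v
... | no v≢w   = subst (PunchView v) (punchIn-punchOut v≢w) (off-v (punchOut v≢w))

extend : ∀ {m N} → Fin (suc m) → (Fin m → Fin N) → Fin (suc m) → Fin (suc N)
extend v f w with v ≟ w
... | yes _    = zero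
... | no v≢w   = suc (f (punchOut v≢w))

extend-at : ∀ {m N} (v : Fin (suc m)) (f : Fin m → Fin N) → extend v f v ≡ zero
extend-at v f with v ≟ v
... | yes _   = refl
... | no v≢v  = ⊥-elim (v≢v refl)

extend-punchIn : ∀ {m N} (v : Fin (suc m)) (f : Fin m → Fin N) (x : Fin m)
  → extend v f (punchIn v x) ≡ suc (f x)
extend-punchIn v f x with v ≟ punchIn v x
... | yes v≡v' = ⊥-elim (punchInᵢ≢i v x (sym v≡v'))
... | no v≢v'  = cong (suc ∘′ f) (trans (punchOut-cong v refl) (punchOut-punchIn v))

extend-injective : ∀ {m N} (v : Fin (suc m)) (f : Fin m → Fin N)
  → Injective _≡_ _≡_ f → Injective _≡_ _≡_ (extend v f)
extend-injective v f f-inj {a} {b} eq with punchView v a | punchView v b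
... | at-v    | at-v    = refl
... | at-v    | off-v y with () ← trans (sym (extend-at v f)) (trans eq (extend-punchIn v f y))
... | off-v x | at-v    with () ← trans (sym (extend-punchIn v f x)) (trans eq (extend-at v f))
... | off-v x | off-v y = cong (punchIn v) (f-inj (suc-injective
    (trans (sym (extend-punchIn v f x)) (trans eq (extend-punchIn v f y)))))

link : ∀ {k N} → TripleColouring k (suc N) → EdgeColouring k N
link c = record
  { col  = λ a b → col3 c zero (suc a) (suc b)
  ; csym = λ a b → c3-23 c zero (suc a) (suc b) }

module Lift {k m N : ℕ} (H : Hypergraph3 (suc m)) (v : Fin (suc m))
  (transversal : IsTransversalVertex H v) (c : TripleColouring k (suc N))
  (f : Fin m → Fin N) (i : Fin k)
  (mono : ∀ x y → Adj (trace H v) x y → col (link c) (f x) (f y) ≡ i) where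

  F : Fin (suc m) → Fin (suc N)
  F = extend v f

  -- An edge written with v first is coloured i: its other two vertices are
  -- off v (edges have distinct vertices), so it is the lift of a trace edge.
  colour-at-v : ∀ y z → Edge H v y z → col3 c (F v) (F y) (F z) ≡ i
  colour-at-v y z e with punchView v y | punchView v z
  ... | at-v    | _       = ⊥-elim (proj₁ (distinct H e) refl)
  ... | off-v x | at-v    = ⊥-elim (proj₂ (proj₂ (distinct H e)) refl)
  ... | off-v x | off-v x' = begin
      col3 c (F v) (F (punchIn v x)) (F (punchIn v x'))
        ≡⟨ cong₂ (λ a b → col3 c a b (F (punchIn v x'))) (extend-at v f) (extend-punchIn v f x) ⟩
      col3 c zero (suc (f x)) (F (punchIn v x'))
        ≡⟨ cong (col3 c zero (suc (f x))) (extend-punchIn v f x') ⟩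
      col3 c zero (suc (f x)) (suc (f x'))
        ≡⟨ mono x x' e ⟩
      i ∎
    where open ≡-Reasoning

  -- Every edge contains v; by the symmetry of H and of c we may move v to
  -- the first position and apply colour-at-v.
  colour : ∀ x y z → Edge H x y z → col3 c (F x) (F y) (F z) ≡ i
  colour x y z e with transversal x y z e
  ... | inj₁ refl        = colour-at-v y z e
  ... | inj₂ (inj₁ refl) = trans (c3-12 c (F x) (F v) (F z)) (colour-at-v x z (swap₁₂ H e))
  ... | inj₂ (inj₂ refl) = trans (c3-23 c (F x) (F y) (F v))
      (trans (c3-12 c (F x) (F v) (F y)) (colour-at-v x y (swap₁₂ H (swap₂₃ H e))))

lift-copy : ∀ {k m N} (H : Hypergraph3 (suc m)) (v : Fin (suc m))
  → IsTransversalVertex H v → (c : TripleColouring k (suc N))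
  → MonoCopy (trace H v) (link c) → MonoCopy3 H c
lift-copy H v transversal c (f , f-inj , i , mono) =
  extend v f , extend-injective v f f-inj , i , Lift.colour H v transversal c f i mono

arrows-lift : ∀ {k m N} (H : Hypergraph3 (suc m)) (v : Fin (suc m))
  → IsTransversalVertex H v → Arrows k (trace H v) N → Arrows3 k H (suc N)
arrows-lift H v transversal arrowsG c = lift-copy H v transversal c (arrowsG (link c))

mainTheorem12 : (k : ℕ) → 1 ≤ k → {m : ℕ} → (H : Hypergraph3 (suc m)) → (v : Fin (suc m))
    → IsTransversalVertex H v
    → (rH rG : ℕ) → IsRamseyNumber3 k H rH → IsRamseyNumber k (trace H v) rG
    → rH ≤ rG + 1
mainTheorem12 k _ H v transversal rH rG (_ , rH-least) (arrowsG , _) =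
  subst (rH ≤_) (+-comm 1 rG) (rH-least (suc rG) (arrows-lift H v transversal arrowsG))
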